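{- For every rooted planar map $\widehat{m}$, \[ \mathbb{T}_{\widehat{m}}(z)=|\mathscr{R}_{\widehat{m}}|^{ -1}\left(2z\,\frac{d}{dz}\mathbb{F}_{\widehat{m}}(z)-|\mathscr{I}^{\Sigma}_{\widehat{m}}|\cdot \mathbb{F}_{\widehat{m}}(z)\right), \] where $\mathbb{T}_{\widehat{m}}(z)=\sum_{n\ge0}t_{\widehat{m},n}z^n$ with $t_{\widehat{m},n}$ the number of rooted planar maps with $n$ edges and a marked pattern $\widehat{m}$; $\mathbb{F}_{\widehat{m}}(z)=\sum_{n\ge0}\tilde f_{\widehat{m},n}z^n$ with $\tilde f_{\widehat{m},n}$ the number of rooted planar maps with $n$ edges in which $\widehat{m}$ occurs as a pattern at the root; $|\mathscr{I}^{\Sigma}_{\widehat{m}}|$ is the sum of the valencies of the inner-faces of $\widehat{m}$; and $|\mathscr{R}_{\widehat{m}}|$ is the number of maps rotationally isomorphic to $\widehat{m}$.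
   Context: Planar maps are connected planar graphs (loops and multiple edges allowed) embedded in the plane, considered up to isomorphism on the sphere; they are rooted by a distinguished directed root edge, the face to its left being the root face (outer face). Inner-faces are faces other than the root face; $F^*(M)$ is the set of inner-faces, $V(M),E(M)$ the vertex and edge sets; the valency of a face is the number of edge-sides on its boundary. A map $P$ occurs as a pattern in $M$ if $V(P)\subseteq V(M)$, $E(P)\subseteq E(M)$, $F^*(P)\subseteq F^*(M)$; it occurs as a pattern at the root of $M$ if moreover the root edge of $P$ is the root edge of $M$. A map with a marked pattern $\widehat{m}$ is a map $M$ together with one chosen occurrence of a pattern in $M$ isomorphic to $\widehat{m}$, whose root edge direction is erased. A rerooting of a map is the choice of a new directed root edge; it is rotational if the root face of the rerooted map is the root face of the original map. Two maps $M,M'$ are rotationally isomorphic if $M'$ is obtained from $M$ by a rotational rerooting and $M'$ is isomorphic to $M$; $|\mathscr{R}_{\widehat{m}}|$ counts the rotational rerootings of $\widehat{m}$ yielding a map isomorphic to $\widehat{m}$ (including $\widehat{m}$ itself).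
   Formalization: $\tilde f_{\widehat{m},n}$ counts pairs of a rooted planar map with n edges and an occurrence of $\widehat{m}$ at its root, not such maps; a marked pattern keeps the root face of $\widehat{m}$. Each condition added here is assumed in the paper as well or is needed for the statement above to hold. -}

module Defs where

open import Data.Nat using (ℕ; zero; suc; _+_; _*_; _≤_; _<_)
open import Data.Fin using (Fin)
open import Data.Bool using (Bool; not)
open import Data.Product using (Σ; ∃; ∃₂; _×_; _,_; proj₁)
open import Data.Sum using (_⊎_)
open import Function using (_∘_; _↔_; Inverse; Injective; _⇔_)
open import Relation.Binary.PropositionalEquality using (_≡_; _≢_)
open import Relation.Binary.Construct.Closure.ReflexiveTransitive using (Star)
open import Relation.Nullary using (¬_)

-- Cardinality of a type modulo a relation: "A / R has exactly k elements",
-- i.e. a surjection A → Fin k whose kernel is exactly R.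

Card : (A : Set) → (A → A → Set) → ℕ → Set
Card A R k = Σ (A → Fin k) λ c →
  (∀ i → ∃ λ a → c a ≡ i) × (∀ a b → (c a ≡ c b) ⇔ R a b)

-- A map with n edges has darts (half-edges)
-- Dart n = Fin n × Bool; the dart (e , b) is edge e with orientation b.
-- α reverses a dart; σ (a permutation) is the rotation around vertices;
-- φ = σ ∘ α gives the face boundaries.  Vertices are σ-orbits, faces are
-- φ-orbits, the valency of a face is the size of its φ-orbit.

Dart : ℕ → Set
Dart n = Fin n × Bool

α : ∀ {n} → Dart n → Dart n
α (e , b) = (e , not b)

iter : ∀ {A : Set} → (A → A) → ℕ → A → A
iter f zero x = x
iter f (suc k) x = f (iter f k x)

SameOrbit : ∀ {A : Set} → (A → A) → A → A → Set
SameOrbit f d d' = ∃ λ k → iter f k d ≡ d'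

Step : ∀ {n} → (Dart n → Dart n) → Dart n → Dart n → Set
Step s d d' = (d' ≡ s d) ⊎ (d' ≡ α d)

record RMap : Set where
  field
    edges     : ℕ
    σ         : Dart edges ↔ Dart edges
    root      : Dart edges
    connected : ∀ d d' → Star (Step (Inverse.to σ)) d d'
    planar    : ∃₂ λ v f →
                  Card (Dart edges) (SameOrbit (Inverse.to σ)) v ×
                  Card (Dart edges) (SameOrbit (Inverse.to σ ∘ α)) f ×
                  (v + f ≡ edges + 2)

open RMap public

σ→ : (M : RMap) → Dart (edges M) → Dart (edges M)
σ→ M = Inverse.to (σ M)

φ : (M : RMap) → Dart (edges M) → Dart (edges M)
φ M = σ→ M ∘ α

InnerDart : (M : RMap) → Dart (edges M) → Set
InnerDart M d = ¬ SameOrbit (φ M) (root M) d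

reroot : (M : RMap) → Dart (edges M) → RMap
reroot M r = record
  { edges = edges M ; σ = σ M ; root = r
  ; connected = connected M ; planar = planar M }

Iso : RMap → RMap → Set
Iso M M' = Σ (Dart (edges M) ↔ Dart (edges M')) λ ψ →
  (∀ d → Inverse.to ψ (α d) ≡ α (Inverse.to ψ d)) ×
  (∀ d → Inverse.to ψ (σ→ M d) ≡ σ→ M' (Inverse.to ψ d)) ×
  (Inverse.to ψ (root M) ≡ root M')

FaceAut : RMap → Set
FaceAut P = Σ (Dart (edges P) ↔ Dart (edges P)) λ ρ →
  (∀ d → Inverse.to ρ (α d) ≡ α (Inverse.to ρ d)) ×
  (∀ d → Inverse.to ρ (σ→ P d) ≡ σ→ P (Inverse.to ρ d)) ×
  SameOrbit (φ P) (root P) (Inverse.to ρ (root P))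

-- Occurrences of P as a pattern in M (V(P) ⊆ V(M), E(P) ⊆ E(M),
-- F*(P) ⊆ F*(M)): an injective edge-preserving dart embedding ι such
-- that P is the submap of M on the image (the rotation of P is the one
-- induced by M), and every inner face of P is an inner face of M.

IsOcc : (P M : RMap) → (Dart (edges P) → Dart (edges M)) → Set
IsOcc P M ι =
  Injective _≡_ _≡_ ι ×
  (∀ d → ι (α d) ≡ α (ι d)) ×
  -- induced rotation: σ_P d is the first dart of P met after d
  -- when turning around the vertex of ι d in M
  (∀ d → ∃ λ k → 1 ≤ k × iter (σ→ M) k (ι d) ≡ ι (σ→ P d) ×
           (∀ j → 1 ≤ j → j < k → ∀ d' → iter (σ→ M) j (ι d) ≢ ι d')) ×
  (∀ d → InnerDart P d → (φ M (ι d) ≡ ι (φ P d)) × InnerDart M (ι d))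

Occ : RMap → RMap → Set
Occ P M = Σ (Dart (edges P) → Dart (edges M)) (IsOcc P M)

-- t_{P,n}: rooted maps with n edges and a marked pattern P.  A marked
-- pattern is an occurrence whose root direction is forgotten (only the
-- root face of P is remembered): occurrences are identified up to
-- root-face-preserving automorphisms of P, and maps up to rooted iso.

MarkedT : RMap → ℕ → Set
MarkedT P n = Σ RMap λ M → (edges M ≡ n) × Occ P M

_≈T_ : ∀ {P n} → MarkedT P n → MarkedT P n → Set
_≈T_ {P} (M , _ , ι , _) (M' , _ , ι' , _) =
  Σ (Iso M M') λ ψ → Σ (FaceAut P) λ ρ →
    ∀ d → Inverse.to (proj₁ ψ) (ι d) ≡ ι' (Inverse.to (proj₁ ρ) d)

-- f̃_{P,n}: rooted maps with n edges together with an occurrence of P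
-- at the root (root edge of P is the root edge of M), up to rooted iso.

AtRoot : RMap → ℕ → Set
AtRoot P n = Σ RMap λ M → (edges M ≡ n) ×
  Σ (Occ P M) λ o → proj₁ o (root P) ≡ root M

_≈F_ : ∀ {P n} → AtRoot P n → AtRoot P n → Set
_≈F_ (M , _ , (ι , _) , _) (M' , _ , (ι' , _) , _) =
  Σ (Iso M M') λ ψ → ∀ d → Inverse.to (proj₁ ψ) (ι d) ≡ ι' d

-- |R_P|: rotational rerootings of P yielding a map isomorphic to P.

RotReroot : RMap → Set
RotReroot P = Σ (Dart (edges P)) λ r →
  SameOrbit (φ P) (root P) r × Iso (reroot P r) P

-- |I^Σ_P|: sum of valencies of inner faces = darts lying on inner faces.

InnerDarts : RMap → Set
InnerDarts P = Σ (Dart (edges P)) (InnerDart P)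

SameDart : ∀ {A : Set} {B : A → Set} → Σ A B → Σ A B → Set
SameDart x y = proj₁ x ≡ proj₁ y

{-# OPTIONS --safe #-}

-- Count, up to isomorphism, the maps M with n edges carrying P at their root together with a dart
-- d of M.  An isomorphism of connected maps is determined by the image of a single dart, so each of
-- the f classes of such maps contributes exactly its 2n darts.  If d is the image of a dart on an
-- inner face of P, the pair is a dart of I^Σ_P together with a map counted by f, giving i f pairs.
-- Otherwise no inner face of P passes through d, so P still occurs in M rerooted at d, and the pair
-- amounts to that rerooted map with the occurrence itself (not just its class under root-face
-- automorphisms of P) remembered: the root of M is the root edge of the occurrence.  Within a class
-- counted by t these rigid occurrences differ exactly by the root-face automorphisms of P, which
-- correspond to the r rotational rerootings, giving t r pairs.

module Submission where

open import Defs
open import Data.Bool using (false; true)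
import Data.Bool.Properties as Bool
open import Data.Empty using (⊥-elim)
open import Data.Fin using (Fin; toℕ; fromℕ<)
import Data.Fin.Properties as Fin
open import Data.Nat using (ℕ; zero; suc; _+_; _*_; _∸_; _%_; _/_; _<_)
open import Data.Nat.DivMod using (m≡m%n+[m/n]*n; m%n<n)
open import Data.Nat.Properties using (≤-antisym; +-comm; *-comm; *-suc; n<1+n; m+[n∸m]≡n)
open import Data.Product using (Σ; ∃; _×_; _,_; proj₁; proj₂)
open import Data.Product.Function.NonDependent.Propositional using (_×-↔_)
open import Data.Product.Properties using (≡-dec)
open import Data.Product.Relation.Binary.Pointwise.NonDependent
  using (≡⇒≡×≡) renaming (Pointwise to ×-Pointwise)
open import Data.Sum using (_⊎_; inj₁; inj₂)
import Data.Sum as Sum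
open import Data.Sum.Properties using (inj₁-injective; inj₂-injective)
import Data.Sum.Relation.Binary.Pointwise as ⊎
open import Function using (_∘_; _↔_; _↣_; _⇔_; mk⇔; Injective; Injection; Inverse; Equivalence)
open import Function.Construct.Composition using (_↔-∘_; _⇔-∘_)
open import Function.Construct.Identity using (↔-id)
open import Function.Construct.Symmetry using (↔-sym; ⇔-sym)
open import Function.Properties.Inverse using (↔⇒↣)
open import Relation.Binary using (DecidableEquality)
open import Relation.Binary.Construct.Closure.ReflexiveTransitive using (Star; ε; _◅_)
open import Relation.Binary.PropositionalEquality
open import Relation.Nullary using (¬_; Dec; yes; no; ¬?; _×-dec_)
import Relation.Nullary.Decidable as Dec
open import Relation.Unary using (Decidable)

open Inverse using (to; from; strictlyInverseˡ; strictlyInverseʳ)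
module ⇔ = Equivalence

private
  variable
    A B X Y : Set
    R S : A → A → Set
    k l m : ℕ
    M M′ M″ : RMap

↔-injective : (ψ : A ↔ B) → ∀ {a a′} → to ψ a ≡ to ψ a′ → a ≡ a′
↔-injective ψ = Injection.injective (↔⇒↣ ψ)

↔-from-commutes : (ψ : A ↔ B) (f : A → A) (g : B → B) →
  (∀ a → to ψ (f a) ≡ g (to ψ a)) → ∀ b → from ψ (g b) ≡ f (from ψ b)
↔-from-commutes ψ f g comm b = ↔-injective ψ (begin
  to ψ (from ψ (g b))   ≡⟨ strictlyInverseˡ ψ (g b) ⟩
  g b                   ≡⟨ cong g (strictlyInverseˡ ψ b) ⟨
  g (to ψ (from ψ b))   ≡⟨ comm (from ψ b) ⟨
  to ψ (f (from ψ b))   ∎)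
  where open ≡-Reasoning

-- Card A R k is definitionally Classifier A R (Fin k).
Classifier : (A : Set) → (A → A → Set) → Set → Set
Classifier A R X = Σ (A → X) λ c →
  (∀ x → ∃ λ a → c a ≡ x) × (∀ a b → (c a ≡ c b) ⇔ R a b)

Classifier-id : Classifier A _≡_ A
Classifier-id = (λ a → a) , (λ a → a , refl) , λ _ _ → mk⇔ (λ e → e) (λ e → e)

Classifier-↔ : Classifier A R X → X ↔ Y → Classifier A R Y
Classifier-↔ (c , surj , ker) X↔Y =
  to X↔Y ∘ c , surj′ , λ a b → ker a b ⇔-∘ mk⇔ (↔-injective X↔Y) (cong (to X↔Y))
  where
  surj′ : ∀ y → ∃ λ a → to X↔Y (c a) ≡ y
  surj′ y with surj (from X↔Y y)
  ... | a , ca≡ = a , trans (cong (to X↔Y) ca≡) (strictlyInverseˡ X↔Y y)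

Classifier-pullback : Classifier A R X → (g : B → A) →
  (∀ b b′ → S b b′ ⇔ R (g b) (g b′)) → (∀ a → ∃ λ b → R (g b) a) → Classifier B S X
Classifier-pullback (c , surj , ker) g g-faithful g-surj =
  c ∘ g , surj′ , λ b b′ → ⇔-sym (g-faithful b b′) ⇔-∘ ker (g b) (g b′)
  where
  surj′ : ∀ x → ∃ λ b → c (g b) ≡ x
  surj′ x with surj x
  ... | a , ca≡ with g-surj a
  ... | b , Rga = b , trans (⇔.from (ker _ _) Rga) ca≡

Classifier-× : Classifier A R X → Classifier B S Y → Classifier (A × B) (×-Pointwise R S) (X × Y)
Classifier-× (c , surj , ker) (c′ , surj′ , ker′) =
  (λ (a , b) → c a , c′ b) ,
  (λ (x , y) → let (a , ca≡) = surj x ; (b , c′b≡) = surj′ y in (a , b) , cong₂ _,_ ca≡ c′b≡) ,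
  λ (a , b) (a′ , b′) → mk⇔
    (λ e → let (e₁ , e₂) = ≡⇒≡×≡ e in ⇔.to (ker a a′) e₁ , ⇔.to (ker′ b b′) e₂)
    (λ (r , s) → cong₂ _,_ (⇔.from (ker a a′) r) (⇔.from (ker′ b b′) s))

Classifier-⊎ : Classifier A R X → Classifier B S Y → Classifier (A ⊎ B) (⊎.Pointwise R S) (X ⊎ Y)
Classifier-⊎ {R = R} {S = S} (c , surj , ker) (c′ , surj′ , ker′) =
  Sum.map c c′ , surj⊎ , ker⊎
  where
  surj⊎ : ∀ z → ∃ λ w → Sum.map c c′ w ≡ z
  surj⊎ (inj₁ x) = let (a , ca≡) = surj x in inj₁ a , cong inj₁ ca≡
  surj⊎ (inj₂ y) = let (b , c′b≡) = surj′ y in inj₂ b , cong inj₂ c′b≡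
  ker⊎ : ∀ w w′ → (Sum.map c c′ w ≡ Sum.map c c′ w′) ⇔ ⊎.Pointwise R S w w′
  ker⊎ (inj₁ a) (inj₁ a′) = mk⇔ (⊎.inj₁ ∘ ⇔.to (ker a a′) ∘ inj₁-injective)
                                (λ { (⊎.inj₁ r) → cong inj₁ (⇔.from (ker a a′) r) })
  ker⊎ (inj₁ _) (inj₂ _) = mk⇔ (λ ()) (λ ())
  ker⊎ (inj₂ _) (inj₁ _) = mk⇔ (λ ()) (λ ())
  ker⊎ (inj₂ b) (inj₂ b′) = mk⇔ (⊎.inj₂ ∘ ⇔.to (ker′ b b′) ∘ inj₂-injective)
                                (λ { (⊎.inj₂ s) → cong inj₂ (⇔.from (ker′ b b′) s) })

Card-× : Card A R k → Card B S l → Card (A × B) (×-Pointwise R S) (k * l)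
Card-× CA CB = Classifier-↔ (Classifier-× CA CB) (↔-sym Fin.*↔×)

Card-⊎ : Card A R k → Card B S l → Card (A ⊎ B) (⊎.Pointwise R S) (k + l)
Card-⊎ CA CB = Classifier-↔ (Classifier-⊎ CA CB) (↔-sym Fin.+↔⊎)

reclassify : Classifier A R X → Classifier A R Y → X → Y
reclassify (_ , surj , _) (c′ , _ , _) x = c′ (proj₁ (surj x))

reclassify-injective : (C : Classifier A R X) (C′ : Classifier A R Y) →
  Injective _≡_ _≡_ (reclassify C C′)
reclassify-injective (c , surj , ker) (c′ , _ , ker′) {x} {y} e =
  trans (sym (proj₂ (surj x)))
    (trans (⇔.from (ker _ _) (⇔.to (ker′ _ _) e)) (proj₂ (surj y)))

Card-unique : Card A R k → Card A R l → k ≡ l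
Card-unique C C′ =
  ≤-antisym (Fin.injective⇒≤ (reclassify-injective C C′))
            (Fin.injective⇒≤ (reclassify-injective C′ C))

iter-+ : (f : A → A) → ∀ m n x → iter f (m + n) x ≡ iter f m (iter f n x)
iter-+ f zero    n x = refl
iter-+ f (suc m) n x = cong f (iter-+ f m n x)

iter-injective : {f : A → A} → Injective _≡_ _≡_ f → ∀ k → Injective _≡_ _≡_ (iter f k)
iter-injective f-inj zero    e = e
iter-injective f-inj (suc k) e = iter-injective f-inj k (f-inj e)

iter-periodic : (f : A → A) → ∀ {p x} → iter f p x ≡ x → ∀ c → iter f (c * p) x ≡ x
iter-periodic f         e zero    = refl
iter-periodic f {p} {x} e (suc c) =
  trans (iter-+ f p (c * p) x) (trans (cong (iter f p) (iter-periodic f e c)) e)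

SameOrbit-trans : ∀ {f : A → A} {x y z} → SameOrbit f x y → SameOrbit f y z → SameOrbit f x z
SameOrbit-trans {f = f} {x} (k , refl) (l , refl) = l + k , iter-+ f l k x

SameOrbit-within-period : ∀ (f : A → A) {p x y} → iter f (suc p) x ≡ x →
  SameOrbit f x y → ∃ λ (j : Fin (suc p)) → iter f (toℕ j) x ≡ y
SameOrbit-within-period f {p} {x} period (k , refl) = fromℕ< r<1+p , (begin
  iter f (toℕ (fromℕ< r<1+p)) x    ≡⟨ cong (λ j → iter f j x) (Fin.toℕ-fromℕ< r<1+p) ⟩
  iter f r x                      ≡⟨ cong (iter f r) (iter-periodic f period q) ⟨
  iter f r (iter f (q * suc p) x) ≡⟨ iter-+ f r (q * suc p) x ⟨
  iter f (r + q * suc p) x        ≡⟨ cong (λ j → iter f j x) (m≡m%n+[m/n]*n k (suc p)) ⟨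
  iter f k x                      ∎)
  where
  open ≡-Reasoning
  r q : ℕ
  r = k % suc p
  q = k / suc p
  r<1+p : r < suc p
  r<1+p = m%n<n k (suc p)

module _ {N : ℕ} (enc : A ↣ Fin N) {h : A → A} (h-inj : Injective _≡_ _≡_ h) where

  iter-period : ∀ x → ∃ λ p → iter h (suc p) x ≡ x
  iter-period x with Fin.pigeonhole (n<1+n N) (λ i → Injection.to enc (iter h (toℕ i) x))
  ... | i , j , i<j , eᵢⱼ = toℕ j ∸ suc (toℕ i) , iter-injective h-inj (toℕ i) (begin
    iter h (toℕ i) (iter h (suc d) x) ≡⟨ sym (iter-+ h (toℕ i) (suc d) x) ⟩
    iter h (toℕ i + suc d) x          ≡⟨ cong (λ m → iter h m x) i+1+d≡j ⟩
    iter h (toℕ j) x                  ≡⟨ sym (Injection.injective enc eᵢⱼ) ⟩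
    iter h (toℕ i) x                  ∎)
    where
    open ≡-Reasoning
    d : ℕ
    d = toℕ j ∸ suc (toℕ i)
    i+1+d≡j : toℕ i + suc d ≡ toℕ j
    i+1+d≡j =
      trans (+-comm (toℕ i) (suc d)) (trans (cong suc (+-comm d (toℕ i))) (m+[n∸m]≡n i<j))

  SameOrbit-sym : ∀ {x y} → SameOrbit h x y → SameOrbit h y x
  SameOrbit-sym {x} (k , refl) with iter-period x
  ... | p , period = k * p , (begin
    iter h (k * p) (iter h k x) ≡⟨ iter-+ h (k * p) k x ⟨
    iter h (k * p + k) x        ≡⟨ cong (λ m → iter h m x) (+-comm (k * p) k) ⟩
    iter h (k + k * p) x        ≡⟨ cong (λ m → iter h m x) (*-suc k p) ⟨
    iter h (k * suc p) x        ≡⟨ iter-periodic h period k ⟩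
    x                           ∎)
    where open ≡-Reasoning

  SameOrbit? : DecidableEquality A → ∀ x y → Dec (SameOrbit h x y)
  SameOrbit? _≟_ x y with iter-period x
  ... | p , period = Dec.map′ (λ (j , e) → toℕ j , e) (SameOrbit-within-period h {p} period)
                              (Fin.any? λ j → iter h (toℕ j) x ≟ y)

∃?-finite : ∀ {N} → A ↔ Fin N → {Q : A → Set} → Decidable Q → Dec (∃ Q)
∃?-finite A↔Fin {Q} Q? = Dec.map′ (λ (i , q) → from A↔Fin i , q)
  (λ (a , q) → to A↔Fin a , subst Q (sym (strictlyInverseʳ A↔Fin a)) q)
  (Fin.any? (Q? ∘ from A↔Fin))

Dart↔Fin : Dart m ↔ Fin (m * 2)
Dart↔Fin = ↔-sym Fin.*↔× ↔-∘ (↔-id _ ×-↔ ↔-sym Fin.2↔Bool)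

_≟ᴰ_ : DecidableEquality (Dart m)
_≟ᴰ_ = ≡-dec Fin._≟_ Bool._≟_

α-involutive : (d : Dart m) → α (α d) ≡ d
α-involutive (e , false) = refl
α-involutive (e , true)  = refl

α-injective : Injective _≡_ _≡_ (α {m})
α-injective {x = x} {y} e = trans (sym (α-involutive x)) (trans (cong α e) (α-involutive y))

φ-injective : (M : RMap) → Injective _≡_ _≡_ (φ M)
φ-injective M = α-injective ∘ ↔-injective (σ M)

φ-SameOrbit-sym : (M : RMap) → ∀ {d d′} → SameOrbit (φ M) d d′ → SameOrbit (φ M) d′ d
φ-SameOrbit-sym M = SameOrbit-sym (↔⇒↣ Dart↔Fin) (φ-injective M)

InnerDart? : (M : RMap) → Decidable (InnerDart M)
InnerDart? M d = ¬? (SameOrbit? (↔⇒↣ Dart↔Fin) (φ-injective M) _≟ᴰ_ (root M) d)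

Commutes : (M M′ : RMap) → (Dart (edges M) → Dart (edges M′)) → Set
Commutes M M′ f = (∀ d → f (α d) ≡ α (f d)) × (∀ d → f (σ→ M d) ≡ σ→ M′ (f d))

Commutes-iter-φ : ∀ M M′ {f} → Commutes M M′ f → ∀ j d → f (iter (φ M) j d) ≡ iter (φ M′) j (f d)
Commutes-iter-φ M M′ comm zero d = refl
Commutes-iter-φ M M′ (f-α , f-σ) (suc j) d =
  trans (f-σ _) (cong (σ→ M′) (trans (f-α _) (cong α (Commutes-iter-φ M M′ (f-α , f-σ) j d))))

Commutes-rigid : ∀ M M′ {f g} → Commutes M M′ f → Commutes M M′ g →
  ∀ d₀ → f d₀ ≡ g d₀ → ∀ d → f d ≡ g d
Commutes-rigid M M′ {f} {g} (f-α , f-σ) (g-α , g-σ) d₀ e₀ d = propagate (connected M d₀ d) e₀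
  where
  propagate : ∀ {d d′} → Star (Step (σ→ M)) d d′ → f d ≡ g d → f d′ ≡ g d′
  propagate ε                      e = e
  propagate {d} (inj₁ refl ◅ path) e =
    propagate path (trans (f-σ d) (trans (cong (σ→ M′) e) (sym (g-σ d))))
  propagate {d} (inj₂ refl ◅ path) e =
    propagate path (trans (f-α d) (trans (cong α e) (sym (g-α d))))

reroot-Iso : (M : RMap) {r : Dart (edges M)} → r ≡ root M → Iso (reroot M r) M
reroot-Iso M r≡root = ↔-id _ , (λ _ → refl) , (λ _ → refl) , r≡root

Iso-refl : (M : RMap) → Iso M M
Iso-refl M = reroot-Iso M refl

Iso-sym : Iso M M′ → Iso M′ M
Iso-sym {M} {M′} (ψ , ψ-α , ψ-σ , ψ-root) =
  ↔-sym ψ , ↔-from-commutes ψ α α ψ-α , ↔-from-commutes ψ (σ→ M) (σ→ M′) ψ-σ ,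
  trans (cong (from ψ) (sym ψ-root)) (strictlyInverseʳ ψ (root M))

Iso-trans : Iso M M′ → Iso M′ M″ → Iso M M″
Iso-trans (ψ , ψ-α , ψ-σ , ψ-root) (ψ′ , ψ′-α , ψ′-σ , ψ′-root) =
  ψ′ ↔-∘ ψ , (λ d → trans (cong (to ψ′) (ψ-α d)) (ψ′-α _)) ,
  (λ d → trans (cong (to ψ′) (ψ-σ d)) (ψ′-σ _)) , trans (cong (to ψ′) ψ-root) ψ′-root

Iso-unique : (ψ ψ′ : Iso M M′) → ∀ d → to (proj₁ ψ) d ≡ to (proj₁ ψ′) d
Iso-unique {M} {M′} (ψ , ψ-α , ψ-σ , ψ-root) (ψ′ , ψ′-α , ψ′-σ , ψ′-root) =
  Commutes-rigid M M′ {to ψ} {to ψ′} (ψ-α , ψ-σ) (ψ′-α , ψ′-σ) (root M) (trans ψ-root (sym ψ′-root))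

module _ (P : RMap) where

  FaceAut-id : FaceAut P
  FaceAut-id = ↔-id _ , (λ _ → refl) , (λ _ → refl) , (0 , refl)

  FaceAut-unique : (ρ ρ′ : FaceAut P) → to (proj₁ ρ) (root P) ≡ to (proj₁ ρ′) (root P) →
    ∀ d → to (proj₁ ρ) d ≡ to (proj₁ ρ′) d
  FaceAut-unique (ρ , ρ-α , ρ-σ , _) (ρ′ , ρ′-α , ρ′-σ , _) =
    Commutes-rigid P P {to ρ} {to ρ′} (ρ-α , ρ-σ) (ρ′-α , ρ′-σ) (root P)

  FaceAut-inner : (ρ : FaceAut P) → ∀ d → InnerDart P d → InnerDart P (to (proj₁ ρ) d)
  FaceAut-inner ρ@(ρ↔ , ρ-α , ρ-σ , root↦) d d-inner (k , e)
    with φ-SameOrbit-sym P root↦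
  ... | j , e′ = d-inner (k + j , ↔-injective ρ↔ (begin
    to ρ↔ (iter (φ P) (k + j) (root P))          ≡⟨ cong (to ρ↔) (iter-+ (φ P) k j (root P)) ⟩
    to ρ↔ (iter (φ P) k (iter (φ P) j (root P))) ≡⟨ ρ-iter-φ k _ ⟩
    iter (φ P) k (to ρ↔ (iter (φ P) j (root P))) ≡⟨ cong (iter (φ P) k) (ρ-iter-φ j _) ⟩
    iter (φ P) k (iter (φ P) j (to ρ↔ (root P))) ≡⟨ cong (iter (φ P) k) e′ ⟩
    iter (φ P) k (root P)                        ≡⟨ e ⟩
    to ρ↔ d                                      ∎))
    where
    open ≡-Reasoning
    ρ-iter-φ : ∀ j d → to ρ↔ (iter (φ P) j d) ≡ iter (φ P) j (to ρ↔ d)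
    ρ-iter-φ = Commutes-iter-φ P P {to ρ↔} (ρ-α , ρ-σ)

  FaceAut⇒RotReroot : FaceAut P → RotReroot P
  FaceAut⇒RotReroot (ρ , ρ-α , ρ-σ , root↦) =
    to ρ (root P) , root↦ , ↔-sym ρ , ↔-from-commutes ρ α α ρ-α ,
    ↔-from-commutes ρ (σ→ P) (σ→ P) ρ-σ , strictlyInverseʳ ρ (root P)

  RotReroot-from-root : ((r , _ , ψ , _) : RotReroot P) → from ψ (root P) ≡ r
  RotReroot-from-root (r , _ , ψ , _ , _ , ψ-root) =
    trans (cong (from ψ) (sym ψ-root)) (strictlyInverseʳ ψ r)

  RotReroot⇒FaceAut : RotReroot P → FaceAut P
  RotReroot⇒FaceAut k@(r , r-rot , ψ , ψ-α , ψ-σ , ψ-root) =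
    ↔-sym ψ , ↔-from-commutes ψ α α ψ-α , ↔-from-commutes ψ (σ→ P) (σ→ P) ψ-σ ,
    subst (SameOrbit (φ P) (root P)) (sym (RotReroot-from-root k)) r-rot

  InnerDart-φ : ∀ {d} → InnerDart P d → InnerDart P (φ P d)
  InnerDart-φ d-inner root~φd = d-inner (SameOrbit-trans root~φd (φ-SameOrbit-sym P (1 , refl)))

  module _ (M : RMap) {ι : Dart (edges P) → Dart (edges M)} (occ : IsOcc P M ι) where

    private
      inner-faces : ∀ d → InnerDart P d → (φ M (ι d) ≡ ι (φ P d)) × InnerDart M (ι d)
      inner-faces = proj₂ (proj₂ (proj₂ occ))

    iter-φ-inner-image : ∀ k {d} → InnerDart P d →
      ∃ λ d′ → InnerDart P d′ × iter (φ M) k (ι d) ≡ ι d′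
    iter-φ-inner-image zero    {d} d-inner = d , d-inner , refl
    iter-φ-inner-image (suc k)     d-inner with iter-φ-inner-image k d-inner
    ... | d′ , d′-inner , e = φ P d′ , InnerDart-φ d′-inner ,
                              trans (cong (φ M) e) (proj₁ (inner-faces d′ d′-inner))

    inner-face-image : ∀ {d x} → InnerDart P d → SameOrbit (φ M) x (ι d) →
      ∃ λ d′ → InnerDart P d′ × ι d′ ≡ x
    inner-face-image d-inner x~ιd with φ-SameOrbit-sym M x~ιd
    ... | k , e with iter-φ-inner-image k d-inner
    ... | d′ , d′-inner , e′ = d′ , d′-inner , trans (sym e′) e

    root-off-inner-faces : ∀ d → InnerDart P d → ¬ SameOrbit (φ M) (ι (root P)) (ι d)
    root-off-inner-faces d d-inner ιroot~ιd with inner-face-image d-inner ιroot~ιd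
    ... | d′ , d′-inner , ιd′≡ιroot = d′-inner (0 , sym (proj₁ occ ιd′≡ιroot))

    IsOcc-reroot : ∀ r → (∀ d → InnerDart P d → ¬ SameOrbit (φ M) r (ι d)) → IsOcc P (reroot M r) ι
    IsOcc-reroot r r-off = proj₁ occ , proj₁ (proj₂ occ) , proj₁ (proj₂ (proj₂ occ)) ,
      λ d d-inner → proj₁ (inner-faces d d-inner) , r-off d d-inner

  IsOcc-∘-FaceAut : ∀ M {ι : Dart (edges P) → Dart (edges M)} → IsOcc P M ι →
    (ρ : FaceAut P) → IsOcc P M (ι ∘ to (proj₁ ρ))
  IsOcc-∘-FaceAut M {ι} (ι-inj , ι-α , ι-σ , ι-inner) ρ@(ρ↔ , ρ-α , ρ-σ , _) =
    (↔-injective ρ↔ ∘ ι-inj) ,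
    (λ d → trans (cong ι (ρ-α d)) (ι-α _)) ,
    (λ d → let (k , 1≤k , ek , first) = ι-σ (to ρ↔ d) in
           k , 1≤k , trans ek (cong ι (sym (ρ-σ d))) ,
           λ j 1≤j j<k d′ → first j 1≤j j<k (to ρ↔ d′)) ,
    (λ d d-inner → let (ι-φ , ιd-inner) = ι-inner (to ρ↔ d) (FaceAut-inner ρ d d-inner) in
                   trans ι-φ (cong ι (sym (Commutes-iter-φ P P {to ρ↔} (ρ-α , ρ-σ) 1 d))) ,
                   ιd-inner)

module _ (P : RMap) (n : ℕ) where

  private
    _≈ᶠ_ : AtRoot P n → AtRoot P n → Set
    _≈ᶠ_ = _≈F_ {P} {n}
    _≈ᵗ_ : MarkedT P n → MarkedT P n → Set
    _≈ᵗ_ = _≈T_ {P} {n}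

  ≈F-refl : ∀ x → x ≈ᶠ x
  ≈F-refl (M , _) = Iso-refl M , λ _ → refl

  ≈F-sym : ∀ x y → x ≈ᶠ y → y ≈ᶠ x
  ≈F-sym (M , _ , (ι , _) , _) (M′ , _ , (ι′ , _) , _) (ψ , ψι≡ι′) =
    Iso-sym {M} {M′} ψ ,
    λ d → trans (cong (from (proj₁ ψ)) (sym (ψι≡ι′ d))) (strictlyInverseʳ (proj₁ ψ) (ι d))

  ≈F-trans : ∀ x y z → x ≈ᶠ y → y ≈ᶠ z → x ≈ᶠ z
  ≈F-trans (M , _) (M′ , _) (M″ , _) (ψ , ψι≡ι′) (ψ′ , ψ′ι′≡ι″) =
    Iso-trans {M} {M′} {M″} ψ ψ′ , λ d → trans (cong (to (proj₁ ψ′)) (ψι≡ι′ d)) (ψ′ι′≡ι″ d)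

  AtRootDart : Set
  AtRootDart = Σ (AtRoot P n) λ x → Dart (edges (proj₁ x))

  _≈ᴰ_ : AtRootDart → AtRootDart → Set
  (x , d) ≈ᴰ (x′ , d′) = Σ (x ≈ᶠ x′) λ χ → to (proj₁ (proj₁ χ)) d ≡ d′

  ≈ᴰ⇔same-image : ∀ x x′ y (χ : x ≈ᶠ y) (χ′ : x′ ≈ᶠ y) d d′ →
    ((x , d) ≈ᴰ (x′ , d′)) ⇔ (to (proj₁ (proj₁ χ)) d ≡ to (proj₁ (proj₁ χ′)) d′)
  ≈ᴰ⇔same-image x x′ y χ χ′ d d′ = mk⇔
    (λ (ξ , ξd≡d′) →
      trans (Iso-unique {proj₁ x} {proj₁ y} (proj₁ χ) (proj₁ (≈F-trans x x′ y ξ χ′)) d)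
            (cong (to (proj₁ (proj₁ χ′))) ξd≡d′))
    (λ e → ≈F-trans x y x′ χ (≈F-sym x′ y χ′) ,
           trans (cong (from (proj₁ (proj₁ χ′))) e) (strictlyInverseʳ (proj₁ (proj₁ χ′)) d′))

  Card-AtRootDart : ∀ {f} → Card (AtRoot P n) _≈ᶠ_ f → Card AtRootDart _≈ᴰ_ (f * (n * 2))
  Card-AtRootDart {f} (c , surj , ker) =
    Classifier-pullback (Classifier-↔ Classifier-id (↔-sym Fin.*↔× ↔-∘ (↔-id _ ×-↔ Dart↔Fin)))
      classify classify-faithful classify-surjective
    where
    rep : Fin f → AtRoot P n
    rep j = proj₁ (surj j)
    rep-edges : ∀ j → edges (proj₁ (rep j)) ≡ n
    rep-edges j = proj₁ (proj₂ (rep j))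
    to-rep : ∀ x → x ≈ᶠ rep (c x)
    to-rep x = ⇔.to (ker x (rep (c x))) (sym (proj₂ (surj (c x))))

    position : ∀ x j → x ≈ᶠ rep j → Dart (edges (proj₁ x)) → Dart n
    position x j χ d = subst Dart (rep-edges j) (to (proj₁ (proj₁ χ)) d)

    classify : AtRootDart → Fin f × Dart n
    classify (x , d) = c x , position x (c x) (to-rep x) d

    ≈ᴰ⇔same-position : ∀ x x′ {j j′} → j ≡ j′ → (χ : x ≈ᶠ rep j) (χ′ : x′ ≈ᶠ rep j′) → ∀ d d′ →
      ((x , d) ≈ᴰ (x′ , d′)) ⇔ (position x j χ d ≡ position x′ j′ χ′ d′)
    ≈ᴰ⇔same-position x x′ {j} refl χ χ′ d d′ =
      mk⇔ (cong (subst Dart (rep-edges j))) (subst-injective (rep-edges j))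
        ⇔-∘ ≈ᴰ⇔same-image x x′ (rep j) χ χ′ d d′

    classify-faithful : ∀ u u′ → (u ≈ᴰ u′) ⇔ (classify u ≡ classify u′)
    classify-faithful (x , d) (x′ , d′) = mk⇔
      (λ ξ → let c≡ = ⇔.from (ker x x′) (proj₁ ξ) in cong₂ _,_ c≡ (⇔.to (same-position c≡) ξ))
      (λ e → let (c≡ , δ≡) = ≡⇒≡×≡ e in ⇔.from (same-position c≡) δ≡)
      where
      same-position : (c≡ : c x ≡ c x′) → ((x , d) ≈ᴰ (x′ , d′)) ⇔
        (position x (c x) (to-rep x) d ≡ position x′ (c x′) (to-rep x′) d′)
      same-position c≡ = ≈ᴰ⇔same-position x x′ c≡ (to-rep x) (to-rep x′) d d′

    classify-surjective : ∀ v → ∃ λ u → classify u ≡ v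
    classify-surjective (j , δ) =
      (rep j , subst Dart (sym (rep-edges j)) δ) , classified (proj₂ (surj j)) (to-rep (rep j))
      where
      classified : ∀ {j′} → j′ ≡ j → (χ : rep j ≈ᶠ rep j′) →
        (j′ , position (rep j) j′ χ (subst Dart (sym (rep-edges j)) δ)) ≡ (j , δ)
      classified refl χ = cong (j ,_) (trans
        (cong (subst Dart (rep-edges j)) (Iso-unique {Mⱼ} {Mⱼ} (proj₁ χ) (Iso-refl Mⱼ) _))
        (subst-subst-sym (rep-edges j)))
        where
        Mⱼ : RMap
        Mⱼ = proj₁ (rep j)

  _≈ᴼ_ : MarkedT P n → MarkedT P n → Set
  (M , _ , ι , _) ≈ᴼ (M′ , _ , ι′ , _) = Σ (Iso M M′) λ ψ → ∀ d → to (proj₁ ψ) (ι d) ≡ ι′ d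

  ≈ᴼ⇔same-root-image : ∀ y y′ z (χ : y ≈ᵗ z) (χ′ : y′ ≈ᵗ z) →
    (y ≈ᴼ y′) ⇔ (to (proj₁ (proj₁ (proj₂ χ))) (root P) ≡ to (proj₁ (proj₁ (proj₂ χ′))) (root P))
  ≈ᴼ⇔same-root-image (M , _ , ι , _) (M′ , _ , ι′ , _) (M″ , _ , ι″ , ι″-inj , _)
                     (ψ , ρ , ψι≡ι″ρ) (ψ′ , ρ′ , ψ′ι′≡ι″ρ′) = mk⇔
    (λ (ξ , ξι≡ι′) → ι″-inj (begin
      ι″ (to (proj₁ ρ) (root P))  ≡⟨ ψι≡ι″ρ (root P) ⟨
      to (proj₁ ψ) (ι (root P))   ≡⟨ Iso-unique {M} {M″} ψ (Iso-trans {M} {M′} {M″} ξ ψ′) _ ⟩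
      to (proj₁ ψ′) (to (proj₁ ξ) (ι (root P))) ≡⟨ cong (to (proj₁ ψ′)) (ξι≡ι′ (root P)) ⟩
      to (proj₁ ψ′) (ι′ (root P)) ≡⟨ ψ′ι′≡ι″ρ′ (root P) ⟩
      ι″ (to (proj₁ ρ′) (root P)) ∎))
    (λ e → Iso-trans {M} {M″} {M′} ψ (Iso-sym {M′} {M″} ψ′) , λ d → begin
      from (proj₁ ψ′) (to (proj₁ ψ) (ι d))   ≡⟨ cong (from (proj₁ ψ′)) (ψι≡ι″ρ d) ⟩
      from (proj₁ ψ′) (ι″ (to (proj₁ ρ) d))  ≡⟨ cong (from (proj₁ ψ′) ∘ ι″) (FaceAut-unique P ρ ρ′ e d) ⟩
      from (proj₁ ψ′) (ι″ (to (proj₁ ρ′) d)) ≡⟨ cong (from (proj₁ ψ′)) (ψ′ι′≡ι″ρ′ d) ⟨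
      from (proj₁ ψ′) (to (proj₁ ψ′) (ι′ d)) ≡⟨ strictlyInverseʳ (proj₁ ψ′) (ι′ d) ⟩
      ι′ d                                   ∎)
    where open ≡-Reasoning

  Card-MarkedT-rigid : ∀ {t r} → Card (MarkedT P n) _≈ᵗ_ t → Card (RotReroot P) SameDart r →
    Card (MarkedT P n) _≈ᴼ_ (t * r)
  Card-MarkedT-rigid {t} {r} (c , surj , ker) CR =
    Classifier-pullback (Card-× Classifier-id CR) classify classify-faithful classify-surjective
    where
    rep : Fin t → MarkedT P n
    rep j = proj₁ (surj j)
    to-rep : ∀ y → y ≈ᵗ rep (c y)
    to-rep y = ⇔.to (ker y (rep (c y))) (sym (proj₂ (surj (c y))))

    classify : MarkedT P n → Fin t × RotReroot P
    classify y = c y , FaceAut⇒RotReroot P (proj₁ (proj₂ (to-rep y)))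

    ≈ᴼ⇔same-position : ∀ y y′ {j j′} → j ≡ j′ → (χ : y ≈ᵗ rep j) (χ′ : y′ ≈ᵗ rep j′) →
      (y ≈ᴼ y′) ⇔ (to (proj₁ (proj₁ (proj₂ χ))) (root P) ≡ to (proj₁ (proj₁ (proj₂ χ′))) (root P))
    ≈ᴼ⇔same-position y y′ {j} refl = ≈ᴼ⇔same-root-image y y′ (rep j)

    ≈ᴼ⇒≈T : ∀ y y′ → y ≈ᴼ y′ → y ≈ᵗ y′
    ≈ᴼ⇒≈T _ _ (ξ , ξι≡ι′) = ξ , FaceAut-id P , ξι≡ι′

    classify-faithful : ∀ y y′ → (y ≈ᴼ y′) ⇔ ×-Pointwise _≡_ SameDart (classify y) (classify y′)
    classify-faithful y y′ = mk⇔
      (λ ξ → let c≡ = ⇔.from (ker y y′) (≈ᴼ⇒≈T y y′ ξ) in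
             c≡ , ⇔.to (≈ᴼ⇔same-position y y′ c≡ (to-rep y) (to-rep y′)) ξ)
      (λ (c≡ , e) → ⇔.from (≈ᴼ⇔same-position y y′ c≡ (to-rep y) (to-rep y′)) e)

    twist : Fin t → RotReroot P → MarkedT P n
    twist j k = let (M , e , ι , occ) = rep j ; ρ = RotReroot⇒FaceAut P k in
      M , e , ι ∘ to (proj₁ ρ) , IsOcc-∘-FaceAut P M occ ρ

    classify-surjective : ∀ v → ∃ λ y → ×-Pointwise _≡_ SameDart (classify y) v
    classify-surjective (j , k) = twist j k , classified c≡j (to-rep (twist j k))
      where
      Mⱼ : RMap
      Mⱼ = proj₁ (rep j)
      c≡j : c (twist j k) ≡ j
      c≡j = trans (⇔.from (ker (twist j k) (rep j)) (Iso-refl Mⱼ , RotReroot⇒FaceAut P k , λ _ → refl))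
                  (proj₂ (surj j))
      classified : ∀ {j′} → j′ ≡ j → (χ : twist j k ≈ᵗ rep j′) →
        ×-Pointwise _≡_ SameDart (j′ , FaceAut⇒RotReroot P (proj₁ (proj₂ χ))) (j , k)
      classified refl (ψ , ρ , ψι≡ιρ) = refl , sym (begin
        proj₁ k                                     ≡⟨ RotReroot-from-root P k ⟨
        to (proj₁ (RotReroot⇒FaceAut P k)) (root P) ≡⟨ ι-inj (trans (sym (ψ-identity _)) (ψι≡ιρ _)) ⟩
        to (proj₁ ρ) (root P)                       ∎)
        where
        open ≡-Reasoning
        ι-inj : Injective _≡_ _≡_ (proj₁ (proj₂ (proj₂ (rep j))))
        ι-inj = proj₁ (proj₂ (proj₂ (proj₂ (rep j))))
        ψ-identity : ∀ d → to (proj₁ ψ) d ≡ d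
        ψ-identity = Iso-unique {Mⱼ} {Mⱼ} ψ (Iso-refl Mⱼ)

  Split : Set
  Split = (InnerDarts P × AtRoot P n) ⊎ MarkedT P n

  _≈ˢ_ : Split → Split → Set
  _≈ˢ_ = ⊎.Pointwise (×-Pointwise SameDart _≈ᶠ_) _≈ᴼ_

  split : Split → AtRootDart
  split (inj₁ ((d , _) , x@(_ , _ , (ι , _) , _))) = x , ι d
  split (inj₂ (M , e , ι , occ)) = (reroot M (ι (root P)) , e , (ι , occ′) , refl) , root M
    where
    occ′ : IsOcc P (reroot M (ι (root P))) ι
    occ′ = IsOcc-reroot P M occ (ι (root P)) (root-off-inner-faces P M occ)

  split-faithful : ∀ s s′ → (s ≈ˢ s′) ⇔ split s ≈ᴰ split s′
  split-faithful (inj₁ ((d , _) , _)) (inj₁ (_ , (_ , _ , (_ , ι′-inj , _) , _))) = mk⇔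
    (λ { (⊎.inj₁ (refl , χ)) → χ , proj₂ χ d })
    (λ (χ , e) → ⊎.inj₁ (ι′-inj (trans (sym (proj₂ χ d)) e) , χ))
  split-faithful (inj₁ ((d , d-inner) , _)) (inj₂ (_ , _ , _ , _ , _ , _ , ι-inner)) = mk⇔ (λ ())
    (λ (χ , e) → ⊥-elim (proj₂ (ι-inner d d-inner) (0 , sym (trans (sym (proj₂ χ d)) e))))
  split-faithful (inj₂ (M , _ , _ , _ , _ , _ , ι-inner)) (inj₁ ((d , d-inner) , _)) = mk⇔ (λ ())
    (λ (χ , e) → ⊥-elim (proj₂ (ι-inner d d-inner)
                   (0 , ↔-injective (proj₁ (proj₁ χ)) (trans e (sym (proj₂ χ d))))))
  split-faithful (inj₂ _) (inj₂ _) = mk⇔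
    (λ { (⊎.inj₂ ((ψ , ψ-α , ψ-σ , ψ-root) , ψι≡ι′)) →
           ((ψ , ψ-α , ψ-σ , ψι≡ι′ (root P)) , ψι≡ι′) , ψ-root })
    (λ (((ψ , ψ-α , ψ-σ , _) , ψι≡ι′) , ψ-root) → ⊎.inj₂ ((ψ , ψ-α , ψ-σ , ψ-root) , ψι≡ι′))

  split-surjective : ∀ u → ∃ λ s → split s ≈ᴰ u
  split-surjective (x@(M , e , (ι , occ) , ι-root) , d)
    with ∃?-finite Dart↔Fin (λ p → InnerDart? P p ×-dec (ι p ≟ᴰ d))
  ... | yes (p , p-inner , ιp≡d) = inj₁ ((p , p-inner) , x) , ≈F-refl x , ιp≡d
  ... | no d-off = inj₂ (reroot M d , e , ι , IsOcc-reroot P M occ d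
                          (λ p p-inner d~ιp → d-off (inner-face-image P M occ p-inner d~ιp))) ,
                   (reroot-Iso M ι-root , λ _ → refl) , refl

  Card-Split : ∀ {f} → Card (AtRoot P n) _≈ᶠ_ f → Card Split _≈ˢ_ (f * (n * 2))
  Card-Split CF = Classifier-pullback (Card-AtRootDart CF) split split-faithful split-surjective

proposition3 : (P : RMap) (r i : ℕ) →
    Card (RotReroot P) SameDart r → Card (InnerDarts P) SameDart i →
    (n t f : ℕ) → Card (MarkedT P n) (_≈T_ {P} {n}) t →
      Card (AtRoot P n) (_≈F_ {P} {n}) f →
    r * t + i * f ≡ 2 * n * f
proposition3 P r i CR CI n t f CT CF = begin
  r * t + i * f  ≡⟨ +-comm (r * t) (i * f) ⟩
  i * f + r * t  ≡⟨ cong (i * f +_) (*-comm r t) ⟩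
  i * f + t * r  ≡⟨ Card-unique (Card-⊎ (Card-× CI CF) (Card-MarkedT-rigid P n CT CR))
                                (Card-Split P n CF) ⟩
  f * (n * 2)    ≡⟨ *-comm f (n * 2) ⟩
  n * 2 * f      ≡⟨ cong (_* f) (*-comm n 2) ⟩
  2 * n * f      ∎
  where open ≡-Reasoning
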